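{- Let $H,H'$ be Heyting algebras, $a\in H$, and $f:H\to H'$ a homomorphism such that for every $d'\in\mathcal D_{f(a)}(H')$ there is $d\in\mathcal D_a(H)$ with $f(d)\le d'$. If $\mathcal D_a(H)$ has a smallest element $\Delta_H(a)$, then $\mathcal D_{f(a)}(H')$ has a smallest element $\Delta_{H'}(f(a))$, and $\Delta_{H'}(f(a))=f(\Delta_H(a))$.
   Context: For $a$ in a Heyting algebra $A$, $\mathcal D_a(A)=\{d\in A: a\le d\text{ and }(d\to a)=a\}$; when this filter has a smallest element it is denoted $\Delta_A(a)$. -}

module Defs where

open import Level using (Level; _⊔_)
open import Data.Product using (_×_; Σ-syntax)
open import Relation.Binary.Lattice.Bundles using (HeytingAlgebra)

private
  variable
    c ℓ₁ ℓ₂ c' ℓ₁' ℓ₂' : Level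

record IsHeytingHom (H : HeytingAlgebra c ℓ₁ ℓ₂) (H' : HeytingAlgebra c' ℓ₁' ℓ₂')
                    (f : HeytingAlgebra.Carrier H → HeytingAlgebra.Carrier H')
                    : Set (c ⊔ ℓ₁ ⊔ c' ⊔ ℓ₁') where
  private
    module A = HeytingAlgebra H
    module B = HeytingAlgebra H'
  field
    cong    : ∀ {x y} → x A.≈ y → f x B.≈ f y
    ∧-homo  : ∀ x y → f (x A.∧ y) B.≈ (f x B.∧ f y)
    ∨-homo  : ∀ x y → f (x A.∨ y) B.≈ (f x B.∨ f y)
    ⇨-homo  : ∀ x y → f (x A.⇨ y) B.≈ (f x B.⇨ f y)
    ⊤-homo  : f A.⊤ B.≈ B.⊤
    ⊥-homo  : f A.⊥ B.≈ B.⊥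

𝒟 : (A : HeytingAlgebra c ℓ₁ ℓ₂) → HeytingAlgebra.Carrier A →
    HeytingAlgebra.Carrier A → Set (ℓ₁ ⊔ ℓ₂)
𝒟 A a d = (a ≤ d) × ((d ⇨ a) ≈ a)
  where open HeytingAlgebra A

IsSmallest𝒟 : (A : HeytingAlgebra c ℓ₁ ℓ₂) → HeytingAlgebra.Carrier A →
              HeytingAlgebra.Carrier A → Set (c ⊔ ℓ₁ ⊔ ℓ₂)
IsSmallest𝒟 A a m = 𝒟 A a m × (∀ d → 𝒟 A a d → m ≤ d)
  where open HeytingAlgebra A

module Submission where

open import Defs
open import Level using (Level)
open import Data.Product using (_×_; Σ-syntax; _,_)
open import Relation.Binary.Bundles using (Poset)
open import Relation.Binary.Lattice.Bundles using (HeytingAlgebra)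
import Relation.Binary.Lattice.Properties.MeetSemilattice as MeetProperties
import Relation.Binary.Reasoning.PartialOrder as ≤-Reasoning

least-image : ∀ {c ℓ₁ ℓ₂ c' ℓ₁' ℓ₂' p q}
  (A : Poset c ℓ₁ ℓ₂) (B : Poset c' ℓ₁' ℓ₂')
  (f : Poset.Carrier A → Poset.Carrier B)
  (P : Poset.Carrier A → Set p) (Q : Poset.Carrier B → Set q)
  → (∀ {x y} → Poset._≤_ A x y → Poset._≤_ B (f x) (f y))
  → (∀ {x} → P x → Q (f x))
  → (∀ y → Q y → Σ[ x ∈ Poset.Carrier A ] (P x × Poset._≤_ B (f x) y))
  → ∀ m → P m × (∀ x → P x → Poset._≤_ A m x)
  → Q (f m) × (∀ y → Q y → Poset._≤_ B (f m) y)
least-image A B f P Q mono P⇒Q cofinal m (Pm , m-least) = P⇒Q Pm , f-m-least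
  where
  f-m-least : ∀ y → Q y → Poset._≤_ B (f m) y
  f-m-least y Qy with cofinal y Qy
  ... | x , Px , fx≤y = Poset.trans B (mono (m-least x Px)) fx≤y

module _ {c ℓ₁ ℓ₂ c' ℓ₁' ℓ₂' : Level}
  {H : HeytingAlgebra c ℓ₁ ℓ₂} {H' : HeytingAlgebra c' ℓ₁' ℓ₂'}
  {f : HeytingAlgebra.Carrier H → HeytingAlgebra.Carrier H'}
  (hom : IsHeytingHom H H' f) where

  private
    module A = HeytingAlgebra H
    module B = HeytingAlgebra H'
  open IsHeytingHom hom

  heytingHom-monotone : ∀ {x y} → x A.≤ y → f x B.≤ f y
  heytingHom-monotone {x} {y} x≤y = begin
    f x           ≈⟨ cong (A.Eq.sym (MeetProperties.y≤x⇒x∧y≈y A.meetSemilattice x≤y)) ⟩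
    f (y A.∧ x)   ≈⟨ ∧-homo y x ⟩
    f y B.∧ f x   ≤⟨ B.x∧y≤x (f y) (f x) ⟩
    f y           ∎
    where open ≤-Reasoning B.poset

  heytingHom-𝒟 : ∀ {a d} → 𝒟 H a d → 𝒟 H' (f a) (f d)
  heytingHom-𝒟 {a} {d} (a≤d , d⇨a≈a) = heytingHom-monotone a≤d , f-d⇨a≈a
    where
    f-d⇨a≈a : (f d B.⇨ f a) B.≈ f a
    f-d⇨a≈a = B.Eq.trans (B.Eq.sym (⇨-homo d a)) (cong d⇨a≈a)

corollary2p7 : ∀ {c ℓ₁ ℓ₂ c' ℓ₁' ℓ₂' : Level}
    (H : HeytingAlgebra c ℓ₁ ℓ₂) (H' : HeytingAlgebra c' ℓ₁' ℓ₂')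
    (f : HeytingAlgebra.Carrier H → HeytingAlgebra.Carrier H')
    → IsHeytingHom H H' f
    → (a : HeytingAlgebra.Carrier H)
    → (∀ d' → 𝒟 H' (f a) d' → Σ[ d ∈ HeytingAlgebra.Carrier H ] (𝒟 H a d × HeytingAlgebra._≤_ H' (f d) d'))
    → (Δ : HeytingAlgebra.Carrier H)
    → IsSmallest𝒟 H a Δ
    → IsSmallest𝒟 H' (f a) (f Δ)
corollary2p7 H H' f hom a cofinal =
  least-image (HeytingAlgebra.poset H) (HeytingAlgebra.poset H') f
    (𝒟 H a) (𝒟 H' (f a)) (heytingHom-monotone hom) (heytingHom-𝒟 hom) cofinal
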